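{- For all non-negative integers $n$, \[T_{n+2}^2=F_{n+1}^2+\sum_{k=3}^n\sum_{l=3}^k\{4(T_l+T_{l-1})+\delta_{l,3}-2\}T_{k-l+2}^2F_{n-k+1}^2.\]
   Context: Tribonacci numbers: $T_n=T_{n-1}+T_{n-2}+T_{n-3}+\delta_{n,2}$ for all integers $n$, with $T_n=0$ for $n<2$. Fibonacci numbers: $F_n=F_{n-1}+F_{n-2}$, $F_0=0$, $F_1=1$. $\delta_{i,j}$ is $1$ if $i=j$ and $0$ otherwise. Empty sums are zero. -}

module Defs where

open import Data.Nat using (ℕ; zero; suc; _≤_; _+_; _∸_)
open import Data.Nat.Properties using (_≟_)
open import Data.Integer using (ℤ)
import Data.Integer as ℤ
open import Relation.Nullary using (yes; no)

-- Tribonacci numbers at non-negative indices: T 0 = T 1 = 0, T 2 = 1,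
-- T (n+3) = T (n+2) + T (n+1) + T n  (agrees with the paper's T_n, n ≥ 0).
T : ℕ → ℕ
T 0 = 0
T 1 = 0
T 2 = 1
T (suc (suc (suc n))) = T (suc (suc n)) + T (suc n) + T n

F : ℕ → ℕ
F 0 = 0
F 1 = 1
F (suc (suc n)) = F (suc n) + F n

δ : ℕ → ℕ → ℤ
δ i j with i ≟ j
... | yes _ = ℤ.+ 1
... | no _ = ℤ.+ 0

-- ΣFrom a b f = Σ_{i=a}^{b} f i  (empty, i.e. 0, when b < a)
ΣFrom : ℕ → ℕ → (ℕ → ℤ) → ℤ
ΣFrom a b f = go (suc b ∸ a)
  where
  go : ℕ → ℤ
  go zero = ℤ.+ 0
  go (suc m) = go m ℤ.+ f (a + m)

{-# OPTIONS --safe #-}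
module Submission where

-- With B = Σ T_{n+2}² xⁿ, G = Σ F_{n+1}² xⁿ and S = Σ s_k x^k, where s_k = Σ_{l=3}^k c_l T_{k-l+2}²
-- is the inner sum, the theorem reads B = G (1 + S).  Since G = (1 - x)/(1 - 2x - 2x² + x³),
-- this is (1 - 2x - 2x² + x³) B = (1 - x)(1 + S): finitely many initial coefficients and
-- T_{k+2}² - 2T_{k+1}² - 2T_k² + T_{k-1}² = s_k - s_{k-1} for k ≥ 4.  The latter is a polynomial
-- identity in three consecutive Tribonacci numbers once s_k has a closed form
-- 2 s_k = Q(T_k, T_{k+1}, T_{k+2}) with Q quadratic, and that closed form is proved the same way,
-- because S = C B where C = Σ_{l≥3} c_l x^l = x³ (7 - 4x + 2x² - 2x³ + x⁴)/(1 - 2x + x⁴).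
-- Power series identities are compared coefficientwise: multiplication by a polynomial with
-- constant term 1 is injective.

module IntegerSequences where
  open import Data.Integer using (ℤ; +_; _+_; _-_; _*_)
  import Data.Integer.Properties as ℤ
  open import Algebra.Properties.CommutativeSemigroup ℤ.+-commutativeSemigroup using (interchange)
  open import Data.Integer.Tactic.RingSolver using (solve-∀)
  open import Data.List using (List; []; _∷_)
  open import Data.Nat using (ℕ; zero; suc; _∸_; _≤_; _<_)
  open import Data.Nat.Induction using (<-rec)
  import Data.Nat.Properties as ℕ
  open import Function using (_∘_)
  open import Relation.Binary.PropositionalEquality
  open ≡-Reasoning

  Seq : Set
  Seq = ℕ → ℤ

  Σ< : ℕ → Seq → ℤ
  Σ< zero    f = + 0
  Σ< (suc m) f = Σ< m f + f m

  Σ<-cong : ∀ m {f g : Seq} → (∀ {j} → j < m → f j ≡ g j) → Σ< m f ≡ Σ< m g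
  Σ<-cong zero    eq = refl
  Σ<-cong (suc m) eq = cong₂ _+_ (Σ<-cong m (eq ∘ ℕ.m<n⇒m<1+n)) (eq ℕ.≤-refl)

  Σ<-+ : ∀ m (f g : Seq) → Σ< m (λ j → f j + g j) ≡ Σ< m f + Σ< m g
  Σ<-+ zero    f g = refl
  Σ<-+ (suc m) f g =
    trans (cong (_+ (f m + g m)) (Σ<-+ m f g)) (interchange (Σ< m f) (Σ< m g) (f m) (g m))

  Σ<-*ˡ : ∀ m a (f : Seq) → Σ< m (λ j → a * f j) ≡ a * Σ< m f
  Σ<-*ˡ zero    a f = sym (ℤ.*-zeroʳ a)
  Σ<-*ˡ (suc m) a f =
    trans (cong (_+ a * f m) (Σ<-*ˡ m a f)) (sym (ℤ.*-distribˡ-+ a (Σ< m f) (f m)))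

  Σ<-*ʳ : ∀ m (f : Seq) a → Σ< m (λ j → f j * a) ≡ Σ< m f * a
  Σ<-*ʳ zero    f a = refl
  Σ<-*ʳ (suc m) f a =
    trans (cong (_+ f m * a) (Σ<-*ʳ m f a)) (sym (ℤ.*-distribʳ-+ a (Σ< m f) (f m)))

  Σ<-zeros : ∀ m → Σ< m (λ _ → + 0) ≡ + 0
  Σ<-zeros zero    = refl
  Σ<-zeros (suc m) = trans (ℤ.+-identityʳ _) (Σ<-zeros m)

  Σ<-front : ∀ m (f : Seq) → Σ< (suc m) f ≡ f 0 + Σ< m (f ∘ suc)
  Σ<-front zero    f = ℤ.+-comm (+ 0) (f 0)
  Σ<-front (suc m) f = trans (cong (_+ f (suc m)) (Σ<-front m f)) (ℤ.+-assoc (f 0) _ _)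

  Σ<-dropHead : ∀ m (f : Seq) → f 0 ≡ + 0 → Σ< (suc m) f ≡ Σ< m (f ∘ suc)
  Σ<-dropHead m f f0≡0 =
    trans (Σ<-front m f) (trans (cong (_+ Σ< m (f ∘ suc)) f0≡0) (ℤ.+-identityˡ _))

  Σ<-reverse : ∀ m (f : Seq) → Σ< m f ≡ Σ< m (λ j → f (m ∸ suc j))
  Σ<-reverse zero    f = refl
  Σ<-reverse (suc m) f = begin
    Σ< m f + f m                          ≡⟨ cong (_+ f m) (Σ<-reverse m f) ⟩
    Σ< m (λ j → f (m ∸ suc j)) + f m      ≡⟨ ℤ.+-comm _ (f m) ⟩
    f m + Σ< m (λ j → f (m ∸ suc j))      ≡⟨ Σ<-front m (λ j → f (m ∸ j)) ⟨
    Σ< (suc m) (λ j → f (m ∸ j))          ∎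

  _⋆_ : Seq → Seq → Seq
  (u ⋆ v) n = Σ< (suc n) (λ j → u j * v (n ∸ j))

  ⋆-comm : ∀ u v → u ⋆ v ≗ v ⋆ u
  ⋆-comm u v n = trans (Σ<-reverse (suc n) _) (Σ<-cong (suc n) λ {j} j<1+n →
    trans (ℤ.*-comm (u (n ∸ j)) _) (cong (λ i → v i * u (n ∸ j)) (ℕ.m∸[m∸n]≡n (ℕ.≤-pred j<1+n))))

  ⋆-congˡ : ∀ {u u′} v → u ≗ u′ → u ⋆ v ≗ u′ ⋆ v
  ⋆-congˡ v eq n = Σ<-cong (suc n) λ {j} _ → cong (_* v (n ∸ j)) (eq j)

  ⋆-+ˡ : ∀ u u′ v → (λ n → u n + u′ n) ⋆ v ≗ λ n → (u ⋆ v) n + (u′ ⋆ v) n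
  ⋆-+ˡ u u′ v n = trans (Σ<-cong (suc n) λ {j} _ → ℤ.*-distribʳ-+ (v (n ∸ j)) (u j) (u′ j))
                        (Σ<-+ (suc n) _ _)

  ⋆-*ˡ : ∀ a u v → (λ n → a * u n) ⋆ v ≗ λ n → a * (u ⋆ v) n
  ⋆-*ˡ a u v n = trans (Σ<-cong (suc n) λ {j} _ → ℤ.*-assoc a (u j) _) (Σ<-*ˡ (suc n) a _)

  δ₀ : Seq
  δ₀ zero    = + 1
  δ₀ (suc n) = + 0

  ⋆-identityˡ : ∀ v → δ₀ ⋆ v ≗ v
  ⋆-identityˡ v n = begin
    Σ< (suc n) (λ j → δ₀ j * v (n ∸ j))   ≡⟨ Σ<-front n _ ⟩
    + 1 * v n + Σ< n (λ _ → + 0)          ≡⟨ cong₂ _+_ (ℤ.*-identityˡ (v n)) (Σ<-zeros n) ⟩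
    v n + + 0                             ≡⟨ ℤ.+-identityʳ (v n) ⟩
    v n                                   ∎

  shift : Seq → Seq
  shift u zero    = + 0
  shift u (suc n) = u n

  shift-cong : ∀ {u v} → u ≗ v → shift u ≗ shift v
  shift-cong eq zero    = refl
  shift-cong eq (suc n) = eq n

  shift-⋆ : ∀ u v → shift u ⋆ v ≗ shift (u ⋆ v)
  shift-⋆ u v zero    = refl
  shift-⋆ u v (suc n) = Σ<-dropHead (suc n) _ refl

  -- (a₀ ∷ … ∷ a_d ∷ []) ⊙ u has generating function (a₀ + … + a_d x^d) U(x), shift being
  -- multiplication by x; so P ⊙ u ≗ N ⊙ δ₀ says U = N / P.
  _⊙_ : List ℤ → Seq → Seq
  ([]      ⊙ u) n = + 0
  ((a ∷ P) ⊙ u) n = a * u n + (P ⊙ shift u) n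

  ⊙-cong : ∀ P {u v} → u ≗ v → P ⊙ u ≗ P ⊙ v
  ⊙-cong []      eq n = refl
  ⊙-cong (a ∷ P) eq n = cong₂ (λ x y → a * x + y) (eq n) (⊙-cong P (shift-cong eq) n)

  ⊙-+ : ∀ P u v → P ⊙ (λ n → u n + v n) ≗ λ n → (P ⊙ u) n + (P ⊙ v) n
  ⊙-+ []      u v n = refl
  ⊙-+ (a ∷ P) u v n = begin
    a * (u n + v n) + (P ⊙ shift (λ m → u m + v m)) n
      ≡⟨ cong (_+_ (a * (u n + v n))) (trans (⊙-cong P shift-+ n) (⊙-+ P (shift u) (shift v) n)) ⟩
    a * (u n + v n) + ((P ⊙ shift u) n + (P ⊙ shift v) n)
      ≡⟨ distribute a (u n) (v n) _ _ ⟩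
    (a * u n + (P ⊙ shift u) n) + (a * v n + (P ⊙ shift v) n) ∎
    where
    shift-+ : shift (λ m → u m + v m) ≗ λ m → shift u m + shift v m
    shift-+ zero    = refl
    shift-+ (suc m) = refl
    distribute : ∀ a x y X Y → a * (x + y) + (X + Y) ≡ (a * x + X) + (a * y + Y)
    distribute = solve-∀

  ⊙-*ʳ : ∀ P a u → P ⊙ (λ n → a * u n) ≗ λ n → a * (P ⊙ u) n
  ⊙-*ʳ []      a u n = sym (ℤ.*-zeroʳ a)
  ⊙-*ʳ (b ∷ P) a u n = begin
    b * (a * u n) + (P ⊙ shift (λ m → a * u m)) n
      ≡⟨ cong (_+_ (b * (a * u n))) (trans (⊙-cong P shift-* n) (⊙-*ʳ P a (shift u) n)) ⟩
    b * (a * u n) + a * (P ⊙ shift u) n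
      ≡⟨ factor a b (u n) _ ⟩
    a * (b * u n + (P ⊙ shift u) n) ∎
    where
    shift-* : shift (λ m → a * u m) ≗ λ m → a * shift u m
    shift-* zero    = sym (ℤ.*-zeroʳ a)
    shift-* (suc m) = refl
    factor : ∀ a b x X → b * (a * x) + a * X ≡ a * (b * x + X)
    factor = solve-∀

  ⊙-⋆ : ∀ P u v → (P ⊙ u) ⋆ v ≗ P ⊙ (u ⋆ v)
  ⊙-⋆ []      u v n = Σ<-zeros (suc n)
  ⊙-⋆ (a ∷ P) u v n = begin
    ((λ m → a * u m + (P ⊙ shift u) m) ⋆ v) n
      ≡⟨ ⋆-+ˡ (λ m → a * u m) (P ⊙ shift u) v n ⟩
    ((λ m → a * u m) ⋆ v) n + ((P ⊙ shift u) ⋆ v) n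
      ≡⟨ cong₂ _+_ (⋆-*ˡ a u v n) (⊙-⋆ P (shift u) v n) ⟩
    a * (u ⋆ v) n + (P ⊙ (shift u ⋆ v)) n
      ≡⟨ cong (_+_ (a * (u ⋆ v) n)) (⊙-cong P (shift-⋆ u v) n) ⟩
    a * (u ⋆ v) n + (P ⊙ shift (u ⋆ v)) n ∎

  ⊙-⋆-quotient : ∀ P N u v → P ⊙ u ≗ N ⊙ δ₀ → P ⊙ (u ⋆ v) ≗ N ⊙ v
  ⊙-⋆-quotient P N u v U≡N/P n = begin
    (P ⊙ (u ⋆ v)) n      ≡⟨ ⊙-⋆ P u v n ⟨
    ((P ⊙ u) ⋆ v) n      ≡⟨ ⋆-congˡ v U≡N/P n ⟩
    ((N ⊙ δ₀) ⋆ v) n     ≡⟨ ⊙-⋆ N δ₀ v n ⟩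
    (N ⊙ (δ₀ ⋆ v)) n     ≡⟨ ⊙-cong N (⋆-identityˡ v) n ⟩
    (N ⊙ v) n            ∎

  AgreeBelow : ℕ → Seq → Seq → Set
  AgreeBelow n u v = ∀ {m} → m < n → u m ≡ v m

  shift-agree : ∀ {n u v} → AgreeBelow n u v → ∀ {m} → m ≤ n → shift u m ≡ shift v m
  shift-agree below {zero}  _   = refl
  shift-agree below {suc m} m<n = below m<n

  ⊙-shift-local : ∀ P {n u v} → AgreeBelow n u v → (P ⊙ shift u) n ≡ (P ⊙ shift v) n
  ⊙-shift-local []      below = refl
  ⊙-shift-local (a ∷ P) below = cong₂ (λ x y → a * x + y) (shift-agree below ℕ.≤-refl)
    (⊙-shift-local P (λ m<n → shift-agree below (ℕ.<⇒≤ m<n)))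

  ⊙-injective : ∀ P {u v} → (+ 1 ∷ P) ⊙ u ≗ (+ 1 ∷ P) ⊙ v → u ≗ v
  ⊙-injective P {u} {v} eq = <-rec (λ n → u n ≡ v n) step
    where
    peel : ∀ x y → x ≡ + 1 * x + y - y
    peel = solve-∀
    step : ∀ n → AgreeBelow n u v → u n ≡ v n
    step n below = begin
      u n                                            ≡⟨ peel (u n) ((P ⊙ shift u) n) ⟩
      + 1 * u n + (P ⊙ shift u) n - (P ⊙ shift u) n  ≡⟨ cong₂ _-_ (eq n) (⊙-shift-local P below) ⟩
      + 1 * v n + (P ⊙ shift v) n - (P ⊙ shift v) n  ≡⟨ peel (v n) ((P ⊙ shift v) n) ⟨
      v n                                            ∎

module TribonacciSquares where
  open import Defs
  open IntegerSequences
  open import Data.Integer using (ℤ; +_; -_; _+_; _-_; _*_; _^_)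
  import Data.Integer.Properties as ℤ
  open import Data.Integer.Tactic.RingSolver using (solve-∀)
  open import Data.List using (List; []; _∷_)
  open import Data.Nat using (ℕ; zero; suc; _∸_)
  import Data.Nat as ℕ
  import Data.Nat.Properties as ℕ
  open import Function using (_∘_)
  open import Relation.Binary.PropositionalEquality
  open ≡-Reasoning

  tribSq : Seq
  tribSq n = (+ T (2 ℕ.+ n)) ^ 2

  fibSq : Seq
  fibSq n = (+ F (1 ℕ.+ n)) ^ 2

  c : ℕ → ℤ
  c l = (+ 4) * (+ (T l ℕ.+ T (l ∸ 1))) + δ l 3 - + 2

  s : Seq
  s k = ΣFrom 3 k (λ l → c l * tribSq (k ∸ l))

  ΣFrom-3 : ∀ m f → ΣFrom 3 (2 ℕ.+ m) f ≡ Σ< m (λ i → f (3 ℕ.+ i))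
  ΣFrom-3 zero    f = refl
  ΣFrom-3 (suc m) f = cong (_+ f (3 ℕ.+ m)) (ΣFrom-3 m f)

  c₃ : Seq
  c₃ i = c (3 ℕ.+ i)

  s-as-⋆ : ∀ n → s (3 ℕ.+ n) ≡ (c₃ ⋆ tribSq) n
  s-as-⋆ n = ΣFrom-3 (suc n) _

  fibSqDen fibSqNum cDen cNum : List ℤ
  fibSqDen = + 1 ∷ - + 2 ∷ - + 2 ∷ + 1 ∷ []
  fibSqNum = + 1 ∷ - + 1 ∷ []
  cDen     = + 1 ∷ - + 2 ∷ + 0 ∷ + 0 ∷ + 1 ∷ []
  cNum     = + 7 ∷ - + 4 ∷ + 2 ∷ - + 2 ∷ + 1 ∷ []

  -- The polynomial identities below are stated in the unfolded shape of their goals, in which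
  -- δ l 3 and δ₀ evaluate to + 0 and x ^ 2 appears as x * (x * + 1), since the ring solver does
  -- not recognise ℤ's _^_.
  fibSq-rational : fibSqDen ⊙ fibSq ≗ fibSqNum ⊙ δ₀
  fibSq-rational 0 = refl
  fibSq-rational 1 = refl
  fibSq-rational 2 = refl
  fibSq-rational (suc (suc (suc n))) = identity (+ F n) (+ F (suc n))
    where
    identity : ∀ f₀ f₁ →
      let f₂ = f₁ + f₀ ; f₃ = f₂ + f₁ ; f₄ = f₃ + f₂ ; sq = λ x → x * (x * + 1) in
      + 1 * sq f₄ + (- + 2 * sq f₃ + (- + 2 * sq f₂ + (+ 1 * sq f₁ + + 0))) ≡ + 0
    identity = solve-∀

  c₃-rational : cDen ⊙ c₃ ≗ cNum ⊙ δ₀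
  c₃-rational 0 = refl
  c₃-rational 1 = refl
  c₃-rational 2 = refl
  c₃-rational 3 = refl
  c₃-rational 4 = refl
  c₃-rational (suc (suc (suc (suc (suc n))))) = identity (+ T n) (+ T (suc n)) (+ T (suc (suc n)))
    where
    identity : ∀ t₀ t₁ t₂ →
      let t₃ = t₂ + t₁ + t₀ ; t₄ = t₃ + t₂ + t₁ ; t₅ = t₄ + t₃ + t₂ ; t₆ = t₅ + t₄ + t₃
          t₇ = t₆ + t₅ + t₄ ; t₈ = t₇ + t₆ + t₅ ; cₗ = λ x y → + 4 * (x + y) + + 0 - + 2 in
      + 1 * cₗ t₈ t₇ + (- + 2 * cₗ t₇ t₆ + (+ 0 * cₗ t₆ t₅ + (+ 0 * cₗ t₅ t₄
        + (+ 1 * cₗ t₄ t₃ + + 0))))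
        ≡ + 0
    identity = solve-∀

  quadForm : ℤ → ℤ → ℤ → ℤ
  quadForm a b d = - (a * a) - + 2 * a * d + + 2 * b * b - + 4 * b * d + + 3 * d * d - + 1

  Q : Seq
  Q n = quadForm (+ T (3 ℕ.+ n)) (+ T (4 ℕ.+ n)) (+ T (5 ℕ.+ n))

  Q-rational : cDen ⊙ Q ≗ λ n → + 2 * (cNum ⊙ tribSq) n
  Q-rational 0 = refl
  Q-rational 1 = refl
  Q-rational 2 = refl
  Q-rational 3 = refl
  Q-rational (suc (suc (suc (suc n)))) = identity (+ T n) (+ T (suc n)) (+ T (suc (suc n)))
    where
    identity : ∀ t₀ t₁ t₂ →
      let t₃ = t₂ + t₁ + t₀ ; t₄ = t₃ + t₂ + t₁ ; t₅ = t₄ + t₃ + t₂ ; t₆ = t₅ + t₄ + t₃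
          t₇ = t₆ + t₅ + t₄ ; t₈ = t₇ + t₆ + t₅ ; t₉ = t₈ + t₇ + t₆ ; sq = λ x → x * (x * + 1)
          q = λ a b d → - (a * a) - + 2 * a * d + + 2 * b * b - + 4 * b * d + + 3 * d * d - + 1 in
      + 1 * q t₇ t₈ t₉ + (- + 2 * q t₆ t₇ t₈ + (+ 0 * q t₅ t₆ t₇ + (+ 0 * q t₄ t₅ t₆
        + (+ 1 * q t₃ t₄ t₅ + + 0))))
        ≡ + 2 * (+ 7 * sq t₆ + (- + 4 * sq t₅ + (+ 2 * sq t₄ + (- + 2 * sq t₃
          + (+ 1 * sq t₂ + + 0)))))
    identity = solve-∀

  Q≗2c₃⋆tribSq : Q ≗ λ n → + 2 * (c₃ ⋆ tribSq) n
  Q≗2c₃⋆tribSq = ⊙-injective (- + 2 ∷ + 0 ∷ + 0 ∷ + 1 ∷ []) λ n → begin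
    (cDen ⊙ Q) n
      ≡⟨ Q-rational n ⟩
    + 2 * (cNum ⊙ tribSq) n
      ≡⟨ cong (_*_ (+ 2)) (⊙-⋆-quotient cDen cNum c₃ tribSq c₃-rational n) ⟨
    + 2 * (cDen ⊙ (c₃ ⋆ tribSq)) n
      ≡⟨ ⊙-*ʳ cDen (+ 2) (c₃ ⋆ tribSq) n ⟨
    (cDen ⊙ (λ m → + 2 * (c₃ ⋆ tribSq) m)) n ∎

  2s≡Q : ∀ n → + 2 * s (3 ℕ.+ n) ≡ Q n
  2s≡Q n = trans (cong (_*_ (+ 2)) (s-as-⋆ n)) (sym (Q≗2c₃⋆tribSq n))

  tribSq-rational : fibSqDen ⊙ tribSq ≗ λ n → (fibSqNum ⊙ δ₀) n + (fibSqNum ⊙ s) n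
  tribSq-rational 0 = refl
  tribSq-rational 1 = refl
  tribSq-rational 2 = refl
  tribSq-rational 3 = refl
  tribSq-rational (suc (suc (suc (suc n)))) = ℤ.*-cancelˡ-≡ (+ 2) _ _ (begin
    + 2 * (fibSqDen ⊙ tribSq) (4 ℕ.+ n)   ≡⟨ identity (+ T n) (+ T (suc n)) (+ T (suc (suc n))) ⟩
    Q (suc n) - Q n                        ≡⟨ cong₂ _-_ (2s≡Q (suc n)) (2s≡Q n) ⟨
    + 2 * s (4 ℕ.+ n) - + 2 * s (3 ℕ.+ n)  ≡⟨ rearrange (s (4 ℕ.+ n)) (s (3 ℕ.+ n)) ⟩
    + 2 * ((fibSqNum ⊙ δ₀) (4 ℕ.+ n) + (fibSqNum ⊙ s) (4 ℕ.+ n)) ∎)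
    where
    identity : ∀ t₀ t₁ t₂ →
      let t₃ = t₂ + t₁ + t₀ ; t₄ = t₃ + t₂ + t₁ ; t₅ = t₄ + t₃ + t₂ ; t₆ = t₅ + t₄ + t₃
          sq = λ x → x * (x * + 1)
          q = λ a b d → - (a * a) - + 2 * a * d + + 2 * b * b - + 4 * b * d + + 3 * d * d - + 1 in
      + 2 * (+ 1 * sq t₆ + (- + 2 * sq t₅ + (- + 2 * sq t₄ + (+ 1 * sq t₃ + + 0))))
        ≡ q t₄ t₅ t₆ - q t₃ t₄ t₅
    identity = solve-∀
    rearrange : ∀ x y → + 2 * x - + 2 * y ≡ + 2 * (+ 0 + (+ 1 * x + (- + 1 * y + + 0)))
    rearrange = solve-∀

  tribSq-decomposition : tribSq ≗ λ n → fibSq n + (s ⋆ fibSq) n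
  tribSq-decomposition = ⊙-injective (- + 2 ∷ - + 2 ∷ + 1 ∷ []) λ n → begin
    (fibSqDen ⊙ tribSq) n
      ≡⟨ tribSq-rational n ⟩
    (fibSqNum ⊙ δ₀) n + (fibSqNum ⊙ s) n
      ≡⟨ cong₂ _+_ (fibSq-rational n) (⊙-⋆-quotient fibSqDen fibSqNum fibSq s fibSq-rational n) ⟨
    (fibSqDen ⊙ fibSq) n + (fibSqDen ⊙ (fibSq ⋆ s)) n
      ≡⟨ cong (_+_ ((fibSqDen ⊙ fibSq) n)) (⊙-cong fibSqDen (⋆-comm fibSq s) n) ⟩
    (fibSqDen ⊙ fibSq) n + (fibSqDen ⊙ (s ⋆ fibSq)) n
      ≡⟨ ⊙-+ fibSqDen fibSq (s ⋆ fibSq) n ⟨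
    (fibSqDen ⊙ (λ m → fibSq m + (s ⋆ fibSq) m)) n ∎

  tribSq-+2 : ∀ m → (+ T (m ℕ.+ 2)) ^ 2 ≡ tribSq m
  tribSq-+2 m = cong (λ k → (+ T k) ^ 2) (ℕ.+-comm m 2)

  fibSq-+1 : ∀ m → (+ F (m ℕ.+ 1)) ^ 2 ≡ fibSq m
  fibSq-+1 m = cong (λ k → (+ F k) ^ 2) (ℕ.+-comm m 1)

  s⋆fibSq-from3 : ∀ m →
    (s ⋆ fibSq) (2 ℕ.+ m) ≡ Σ< m (λ i → s (3 ℕ.+ i) * fibSq ((2 ℕ.+ m) ∸ (3 ℕ.+ i)))
  s⋆fibSq-from3 m = trans (Σ<-dropHead (2 ℕ.+ m) f refl)
    (trans (Σ<-dropHead (1 ℕ.+ m) (f ∘ suc) refl) (Σ<-dropHead m (f ∘ suc ∘ suc) refl))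
    where
    f : Seq
    f k = s k * fibSq ((2 ℕ.+ m) ∸ k)

  doubleSum-as-⋆ : ∀ n →
    ΣFrom 3 n (λ k → ΣFrom 3 k (λ l → c l * (+ T (k ∸ l ℕ.+ 2)) ^ 2 * (+ F (n ∸ k ℕ.+ 1)) ^ 2))
      ≡ (s ⋆ fibSq) n
  doubleSum-as-⋆ 0             = refl
  doubleSum-as-⋆ 1             = refl
  doubleSum-as-⋆ (suc (suc m)) =
    trans (ΣFrom-3 m _) (trans (Σ<-cong m λ {i} _ → inner i) (sym (s⋆fibSq-from3 m)))
    where
    inner : ∀ i → let x = (2 ℕ.+ m) ∸ (3 ℕ.+ i) in
      ΣFrom 3 (3 ℕ.+ i) (λ l → c l * (+ T ((3 ℕ.+ i) ∸ l ℕ.+ 2)) ^ 2 * (+ F (x ℕ.+ 1)) ^ 2)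
        ≡ s (3 ℕ.+ i) * fibSq x
    inner i = begin
      _ ≡⟨ ΣFrom-3 (suc i) _ ⟩
      Σ< (suc i) (λ j → c₃ j * (+ T (i ∸ j ℕ.+ 2)) ^ 2 * (+ F (x ℕ.+ 1)) ^ 2)
        ≡⟨ Σ<-cong (suc i) (λ {j} _ →
             cong₂ (λ b g → c₃ j * b * g) (tribSq-+2 (i ∸ j)) (fibSq-+1 x)) ⟩
      Σ< (suc i) (λ j → c₃ j * tribSq (i ∸ j) * fibSq x)
        ≡⟨ Σ<-*ʳ (suc i) (λ j → c₃ j * tribSq (i ∸ j)) (fibSq x) ⟩
      (c₃ ⋆ tribSq) i * fibSq x
        ≡⟨ cong (_* fibSq x) (s-as-⋆ i) ⟨
      s (3 ℕ.+ i) * fibSq x ∎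
      where x = (2 ℕ.+ m) ∸ (3 ℕ.+ i)

open import Defs
open import Data.Nat using (ℕ; _+_; _∸_)
open import Data.Integer using (+_; _*_; _-_; _^_)
import Data.Integer as ℤ
open import Relation.Binary.PropositionalEquality using (_≡_; cong₂; module ≡-Reasoning)
open ≡-Reasoning
open IntegerSequences using (_⋆_)
open TribonacciSquares
  using (tribSq; fibSq; s; tribSq-+2; fibSq-+1; tribSq-decomposition; doubleSum-as-⋆)

mainTheorem11 : (n : ℕ) →
    (+ T (n + 2)) ^ 2 ≡
      (+ F (n + 1)) ^ 2 ℤ.+
      ΣFrom 3 n (λ k → ΣFrom 3 k (λ l →
        ((+ 4) * (+ (T l + T (l ∸ 1))) ℤ.+ δ l 3 - + 2)
          * (+ T (k ∸ l + 2)) ^ 2 * (+ F (n ∸ k + 1)) ^ 2))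
mainTheorem11 n = begin
  (+ T (n + 2)) ^ 2          ≡⟨ tribSq-+2 n ⟩
  tribSq n                   ≡⟨ tribSq-decomposition n ⟩
  fibSq n ℤ.+ (s ⋆ fibSq) n  ≡⟨ cong₂ ℤ._+_ (fibSq-+1 n) (doubleSum-as-⋆ n) ⟨
  _                          ∎
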